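{- For every $\epsilon>0$ there is a constant $c_\epsilon$ such that for every graph $G$ with maximum degree $\Delta$, diameter $k$, and a separation of order $s$, $$|V(G)|\leq\begin{cases}(3+\epsilon)\,s\,(\Delta-1)^{(k-1)/2} & \text{if } k \text{ is odd and } \Delta\geq c_\epsilon,\\[2pt] \left(\frac{3}{2}+\epsilon\right)\sqrt{s}\,(\Delta-1)^{k/2} & \text{if } k \text{ is even and } \Delta\geq c_\epsilon\sqrt{s}.\end{cases}$$
   Context: A separation of order $s$ in an $n$-vertex graph $G$ is a partition $(A,S,B)$ of $V(G)$ such that $|A|\leq\frac{2}{3}n$, $|B|\leq\frac{2}{3}n$, $|S|\leq s$, and there is no edge between $A$ and $B$. -}

module Defs where

open import Data.Nat using (ℕ; zero; suc; _+_; _*_; _≤_; _<_)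
open import Data.Fin using (Fin)
open import Data.Bool using (Bool; true; false; if_then_else_)
open import Data.List using (List; map; allFin)
open import Data.Nat.ListAction using (sum)
open import Data.Product using (Σ; _×_; ∃)
open import Relation.Binary.PropositionalEquality using (_≡_)
open import Relation.Nullary using (¬_)
open import Data.Empty using (⊥)

record Graph (n : ℕ) : Set where
  field
    adj     : Fin n → Fin n → Bool
    symm    : ∀ u v → adj u v ≡ adj v u
    irrefl  : ∀ v → adj v v ≡ false
open Graph public

countFin : (n : ℕ) → (Fin n → Bool) → ℕ
countFin n p = sum (map (λ u → if p u then 1 else 0) (allFin n))

degree : ∀ {n} → Graph n → Fin n → ℕ
degree {n} G v = countFin n (adj G v)

MaxDegree : ∀ {n} → Graph n → ℕ → Set
MaxDegree G Δ = (∀ v → degree G v ≤ Δ) × ∃ λ v → degree G v ≡ Δ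

data Walk {n : ℕ} (G : Graph n) : Fin n → Fin n → ℕ → Set where
  here : ∀ {u} → Walk G u u 0
  step : ∀ {u w v m} → adj G u w ≡ true → Walk G w v m → Walk G u v (suc m)

DistLe : ∀ {n} → Graph n → Fin n → Fin n → ℕ → Set
DistLe G u v m = Σ ℕ λ l → l ≤ m × Walk G u v l

Diameter : ∀ {n} → Graph n → ℕ → Set
Diameter G k = (∀ u v → DistLe G u v k)
             × ∃ λ u → ∃ λ v → ∀ l → l < k → ¬ Walk G u v l

data Part : Set where
  inA inS inB : Part

isA isS isB : Part → Bool
isA inA = true
isA _   = false
isS inS = true
isS _   = false
isB inB = true
isB _   = false

-- a separation (A,S,B) of order s, encoded as a map V(G) → {A,S,B}
-- |A| ≤ 2n/3 and |B| ≤ 2n/3 written as 3|A| ≤ 2n, 3|B| ≤ 2n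
IsSeparation : ∀ {n} → Graph n → ℕ → (Fin n → Part) → Set
IsSeparation {n} G s f =
    3 * countFin n (λ v → isA (f v)) ≤ 2 * n
  × 3 * countFin n (λ v → isB (f v)) ≤ 2 * n
  × countFin n (λ v → isS (f v)) ≤ s
  × (∀ u v → f u ≡ inA → f v ≡ inB → adj G u v ≡ false)

HasSeparation : ∀ {n} → Graph n → ℕ → Set
HasSeparation {n} G s = ∃ λ (f : Fin n → Part) → IsSeparation G s f

-- Let S be the separator and R_m the set of vertices within distance m of S. Every walk from A to B
-- passes through S, so a vertex of A ∖ R_m and a vertex of B ∖ R_m are at distance at least 2m + 2.
-- For k = 2j + 1 one of A ∖ R_j, B ∖ R_j is therefore empty, so n ≤ 3 |R_j| because |A|, |B| ≤ 2n/3,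
-- and the Moore bound (Δ − 2) |R_j| ≤ Δ (Δ − 1)^j |S| finishes; ε absorbs Δ/(Δ − 2).
-- For k = 2j every pair in (A ∖ R_{j−1}) × (B ∖ R_{j−1}) has a common vertex x ∈ S within distance j
-- of both, so the product of their sizes is at most Σ_{x ∈ S} (|B_j(x)|/2)², while the size constraints
-- give 2n² ≤ 9 |A ∖ R| |B ∖ R| + 6 n |R|. Together with the Moore bound on |R| and |B_j(x)| this yields
-- n² ≤ (9/4) s (Δ − 1)^k as soon as Δ ≥ 12 and Δ² ≥ 144 s.

module Submission where

open import Data.Nat hiding (_/_)
open import Data.Nat.Properties
open import Data.Bool using (Bool; true; false; if_then_else_; _∧_; _∨_; not)
open import Data.Bool.Properties using (∧-conicalˡ; ∧-conicalʳ; ∨-zeroʳ; ∧-identityʳ)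
open import Data.Fin using (Fin; zero; suc)
open import Data.List using (tabulate)
open import Data.List.Properties using (map-tabulate)
import Data.Nat.ListAction as List
open import Data.Product using (Σ; _×_; ∃; _,_; proj₁; proj₂)
open import Data.Sum using (_⊎_; inj₁; inj₂; [_,_]′)
open import Data.Empty using (⊥; ⊥-elim)
open import Relation.Nullary using (yes; no; does; contradiction)
import Data.Fin.Properties as Fin
open import Function using (_∘_; id)
open import Relation.Binary.PropositionalEquality
open import Algebra.Properties.Semiring.Sum +-*-semiring
  using (sum; sum-cong-≗; ∑-distrib-+; ∑-comm; *-distribˡ-sum; *-distribʳ-sum)
open import Data.Nat.Coprimality using (Coprime)
open import Data.Nat.Tactic.RingSolver
open import Data.Integer as ℤ using (+[1+_]; -[1+_]; +≤+; +<+)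
import Data.Integer.Properties as ℤ
open import Data.Rational as ℚ using (ℚ; mkℚ; _/_; 0ℚ; toℚᵘ; *<*)
open import Data.Rational.Properties using (toℚᵘ-cancel-≤; toℚᵘ-homo-+; toℚᵘ-homo-*; toℚᵘ-fromℚᵘ)
open import Data.Rational.Unnormalised as ℚᵘ using (ℚᵘ; mkℚᵘ; *≤*)
import Data.Rational.Unnormalised.Properties as ℚᵘ
open import Defs

-- Finite sums and counting

sum-mono-≤ : ∀ {n} {f g : Fin n → ℕ} → (∀ i → f i ≤ g i) → sum f ≤ sum g
sum-mono-≤ {zero}  f≤g = z≤n
sum-mono-≤ {suc n} f≤g = +-mono-≤ (f≤g zero) (sum-mono-≤ (f≤g ∘ suc))

sum-const : ∀ n k → sum {n} (λ _ → k) ≡ n * k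
sum-const zero    k = refl
sum-const (suc n) k = cong (k +_) (sum-const n k)

term≤sum : ∀ {n} (f : Fin n → ℕ) i → f i ≤ sum f
term≤sum f zero    = m≤m+n (f zero) _
term≤sum f (suc i) = ≤-trans (term≤sum (f ∘ suc) i) (m≤n+m _ (f zero))

sum-pos⇒term-pos : ∀ {n} (f : Fin n → ℕ) → 0 < sum f → ∃ λ i → 0 < f i
sum-pos⇒term-pos {suc n} f pos with f zero in eq
... | suc _ = zero , subst (0 <_) (sym eq) z<s
... | zero  with sum-pos⇒term-pos (f ∘ suc) pos
...   | i , fi>0 = suc i , fi>0

sum-*-sum : ∀ {m n} (f : Fin m → ℕ) (g : Fin n → ℕ) → sum f * sum g ≡ sum (λ a → sum (λ b → f a * g b))
sum-*-sum {m} {n} f g = trans (*-distribʳ-sum {m} (sum g) f) (sum-cong-≗ {m} λ a → *-distribˡ-sum {n} (f a) g)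

⟦_⟧ : Bool → ℕ
⟦ true  ⟧ = 1
⟦ false ⟧ = 0

⟦⟧≤1 : ∀ b → ⟦ b ⟧ ≤ 1
⟦⟧≤1 true  = ≤-refl
⟦⟧≤1 false = z≤n

⟦∧⟧ : ∀ a b → ⟦ a ∧ b ⟧ ≡ ⟦ a ⟧ * ⟦ b ⟧
⟦∧⟧ true  b = sym (+-identityʳ ⟦ b ⟧)
⟦∧⟧ false b = refl

⟦∨⟧≤ : ∀ a b → ⟦ a ∨ b ⟧ ≤ ⟦ a ⟧ + ⟦ b ⟧
⟦∨⟧≤ true  b = s≤s z≤n
⟦∨⟧≤ false b = ≤-refl

count : ∀ {n} → (Fin n → Bool) → ℕ
count p = sum (⟦_⟧ ∘ p)

countFin≡count : ∀ n p → countFin n p ≡ count p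
countFin≡count n p = begin
  List.sum (Data.List.map (λ u → if p u then 1 else 0) (tabulate id)) ≡⟨ cong List.sum (map-tabulate {n = n} id _) ⟩
  List.sum (tabulate (λ u → if p u then 1 else 0))                   ≡⟨ sum-tabulate {n} _ ⟩
  sum (λ u → if p u then 1 else 0)                                   ≡⟨ sum-cong-≗ (λ u → if≡⟦⟧ (p u)) ⟩
  count p                                                            ∎
  where
  open ≡-Reasoning
  sum-tabulate : ∀ {m} (g : Fin m → ℕ) → List.sum (tabulate g) ≡ sum g
  sum-tabulate {zero}  g = refl
  sum-tabulate {suc m} g = cong (g zero +_) (sum-tabulate (g ∘ suc))
  if≡⟦⟧ : ∀ b → (if b then 1 else 0) ≡ ⟦ b ⟧
  if≡⟦⟧ true  = refl
  if≡⟦⟧ false = refl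

count-mono : ∀ {n} {p q : Fin n → Bool} → (∀ v → p v ≡ true → q v ≡ true) → count p ≤ count q
count-mono {p = p} {q} p⊆q = sum-mono-≤ λ v → ⟦⟧-mono (p v) (q v) (p⊆q v)
  where
  ⟦⟧-mono : ∀ a b → (a ≡ true → b ≡ true) → ⟦ a ⟧ ≤ ⟦ b ⟧
  ⟦⟧-mono true  b a⇒b rewrite a⇒b refl = ≤-refl
  ⟦⟧-mono false b a⇒b = z≤n

count-pos : ∀ {n} (p : Fin n → Bool) {v} → p v ≡ true → 0 < count p
count-pos p {v} pv = ≤-trans (≤-reflexive (cong ⟦_⟧ (sym pv))) (term≤sum (⟦_⟧ ∘ p) v)

count≡0⊎witness : ∀ {n} (p : Fin n → Bool) → count p ≡ 0 ⊎ ∃ λ v → p v ≡ true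
count≡0⊎witness p with count p in eq
... | zero  = inj₁ refl
... | suc _ with sum-pos⇒term-pos (⟦_⟧ ∘ p) (subst (0 <_) (sym eq) z<s)
...   | v , pv>0 = inj₂ (v , ⟦⟧-pos (p v) pv>0)
  where
  ⟦⟧-pos : ∀ b → 0 < ⟦ b ⟧ → b ≡ true
  ⟦⟧-pos true _ = refl

count-split : ∀ {n} (p r : Fin n → Bool) → count p ≡ count (λ v → p v ∧ not (r v)) + count (λ v → p v ∧ r v)
count-split {n} p r = trans (sum-cong-≗ λ v → split (p v) (r v)) (∑-distrib-+ {n} _ _)
  where
  split : ∀ a b → ⟦ a ⟧ ≡ ⟦ a ∧ not b ⟧ + ⟦ a ∧ b ⟧
  split true  true  = refl
  split true  false = refl
  split false b     = refl

sum-⟦⟧*≤count* : ∀ {n} (Q : Fin n → Bool) (h : Fin n → ℕ) {c} → (∀ u → Q u ≡ true → h u ≤ c) →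
                 sum (λ u → ⟦ Q u ⟧ * h u) ≤ count Q * c
sum-⟦⟧*≤count* {n} Q h {c} h≤c = begin
  sum (λ u → ⟦ Q u ⟧ * h u) ≤⟨ sum-mono-≤ (λ u → pointwise u (Q u) refl) ⟩
  sum (λ u → ⟦ Q u ⟧ * c)   ≡⟨ *-distribʳ-sum {n} c _ ⟨
  count Q * c               ∎
  where
  open ≤-Reasoning
  pointwise : ∀ u b → Q u ≡ b → ⟦ b ⟧ * h u ≤ ⟦ b ⟧ * c
  pointwise u true  Qu = *-monoʳ-≤ 1 (h≤c u Qu)
  pointwise u false _  = z≤n

⁅_⁆ : ∀ {n} → Fin n → Fin n → Bool
⁅ x ⁆ v = does (v Fin.≟ x)

x∈⁅x⁆ : ∀ {n} (x : Fin n) → ⁅ x ⁆ x ≡ true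
x∈⁅x⁆ zero    = refl
x∈⁅x⁆ (suc x) = x∈⁅x⁆ x

count-⁅x⁆ : ∀ {n} (x : Fin n) → count ⁅ x ⁆ ≡ 1
count-⁅x⁆ {suc n} zero    = cong suc (trans (sum-const n 0) (*-zeroʳ n))
count-⁅x⁆ {suc n} (suc x) = count-⁅x⁆ x

count-disjoint : ∀ {n} (C p q : Fin n → Bool) → (∀ v → p v ≡ true → q v ≡ true → ⊥) →
                 count (λ v → C v ∧ p v) + count (λ v → C v ∧ q v) ≤ count C
count-disjoint {n} C p q p∩q=∅ =
  ≤-trans (≤-reflexive (sym (∑-distrib-+ {n} _ _))) (sum-mono-≤ λ v → pointwise (C v) (p v) (q v) (p∩q=∅ v))
  where
  pointwise : ∀ c a b → (a ≡ true → b ≡ true → ⊥) → ⟦ c ∧ a ⟧ + ⟦ c ∧ b ⟧ ≤ ⟦ c ⟧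
  pointwise false a     b     _   = z≤n
  pointwise true  true  true  a∩b = ⊥-elim (a∩b refl refl)
  pointwise true  true  false _   = ≤-refl
  pointwise true  false b     _   = ⟦⟧≤1 b

count*count≤ : ∀ {n} (P Q X : Fin n → Bool) (C : Fin n → Fin n → Bool) →
  (∀ a b → P a ≡ true → Q b ≡ true → ∃ λ x → X x ≡ true × C x a ≡ true × C x b ≡ true) →
  count P * count Q ≤ sum (λ x → ⟦ X x ⟧ * (count (λ a → C x a ∧ P a) * count (λ b → C x b ∧ Q b)))
count*count≤ {n} P Q X C cover = begin
  count P * count Q                              ≡⟨ sum-*-sum (⟦_⟧ ∘ P) (⟦_⟧ ∘ Q) ⟩
  sum (λ a → sum (λ b → ⟦ P a ⟧ * ⟦ Q b ⟧))      ≤⟨ sum-mono-≤ (λ a → sum-mono-≤ (covered a)) ⟩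
  sum (λ a → sum (λ b → sum (λ x → w x a b)))    ≡⟨ sum-cong-≗ {n} (λ a → ∑-comm {n} {n} _) ⟩
  sum (λ a → sum (λ x → sum (λ b → w x a b)))    ≡⟨ ∑-comm {n} {n} _ ⟩
  sum (λ x → sum (λ a → sum (λ b → w x a b)))    ≡⟨ sum-cong-≗ {n} factor ⟩
  sum (λ x → ⟦ X x ⟧ * (count (λ a → C x a ∧ P a) * count (λ b → C x b ∧ Q b))) ∎
  where
  open ≤-Reasoning
  w : Fin n → Fin n → Fin n → ℕ
  w x a b = ⟦ X x ⟧ * (⟦ C x a ∧ P a ⟧ * ⟦ C x b ∧ Q b ⟧)
  covered : ∀ a b → ⟦ P a ⟧ * ⟦ Q b ⟧ ≤ sum (λ x → w x a b)
  covered a b = by-cases (P a) (Q b) refl refl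
    where
    by-cases : ∀ p q → P a ≡ p → Q b ≡ q → ⟦ p ⟧ * ⟦ q ⟧ ≤ sum (λ x → w x a b)
    by-cases false _     _  _  = z≤n
    by-cases true  false _  _  = z≤n
    by-cases true  true  Pa Qb with cover a b Pa Qb
    ... | x , Xx , Cxa , Cxb = subst (_≤ sum (λ x → w x a b)) wxab≡1 (term≤sum (λ x → w x a b) x)
      where
      wxab≡1 : w x a b ≡ 1
      wxab≡1 rewrite Xx | Cxa | Cxb | Pa | Qb = refl
  factor : ∀ x → sum (λ a → sum (λ b → w x a b)) ≡ ⟦ X x ⟧ * (count (λ a → C x a ∧ P a) * count (λ b → C x b ∧ Q b))
  factor x = begin-equality
    sum (λ a → sum (λ b → w x a b))                          ≡⟨ sum-cong-≗ {n} (λ a → *-distribˡ-sum {n} ⟦ X x ⟧ _) ⟨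
    sum (λ a → ⟦ X x ⟧ * sum (λ b → ⟦ C x a ∧ P a ⟧ * ⟦ C x b ∧ Q b ⟧)) ≡⟨ *-distribˡ-sum {n} ⟦ X x ⟧ _ ⟨
    ⟦ X x ⟧ * sum (λ a → sum (λ b → ⟦ C x a ∧ P a ⟧ * ⟦ C x b ∧ Q b ⟧)) ≡⟨ cong (⟦ X x ⟧ *_) (sum-*-sum {n} {n} _ _) ⟨
    ⟦ X x ⟧ * (count (λ a → C x a ∧ P a) * count (λ b → C x b ∧ Q b)) ∎

-- Balls in graphs of bounded degree

anyᶠ : ∀ {n} → (Fin n → Bool) → Bool
anyᶠ {zero}  g = false
anyᶠ {suc n} g = g zero ∨ anyᶠ (g ∘ suc)

anyᶠ-intro : ∀ {n} (g : Fin n → Bool) {i} → g i ≡ true → anyᶠ g ≡ true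
anyᶠ-intro g {zero}  gi rewrite gi = refl
anyᶠ-intro g {suc i} gi with g zero
... | true  = refl
... | false = anyᶠ-intro (g ∘ suc) gi

anyᶠ-elim : ∀ {n} (g : Fin n → Bool) → anyᶠ g ≡ true → ∃ λ i → g i ≡ true
anyᶠ-elim {suc n} g any-g with g zero in eq
... | true  = zero , eq
... | false with anyᶠ-elim (g ∘ suc) any-g
...   | i , gi = suc i , gi

⟦anyᶠ⟧≤count : ∀ {n} (g : Fin n → Bool) → ⟦ anyᶠ g ⟧ ≤ count g
⟦anyᶠ⟧≤count {zero}  g = z≤n
⟦anyᶠ⟧≤count {suc n} g = ≤-trans (⟦∨⟧≤ (g zero) _) (+-monoʳ-≤ ⟦ g zero ⟧ (⟦anyᶠ⟧≤count (g ∘ suc)))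

module _ {n : ℕ} (G : Graph n) where

  nbhd : (Fin n → Bool) → Fin n → Bool
  nbhd P v = anyᶠ (λ u → P u ∧ adj G u v)

  nbhd-intro : ∀ {P u v} → P u ≡ true → adj G u v ≡ true → nbhd P v ≡ true
  nbhd-intro {P} {v = v} Pu uv = anyᶠ-intro (λ u → P u ∧ adj G u v) (cong₂ _∧_ Pu uv)

  nbhd-elim : ∀ {P v} → nbhd P v ≡ true → ∃ λ u → P u ≡ true × adj G u v ≡ true
  nbhd-elim {P} {v} Nv with anyᶠ-elim (λ u → P u ∧ adj G u v) Nv
  ... | u , Pu∧uv = u , ∧-conicalˡ _ _ Pu∧uv , ∧-conicalʳ (P u) _ Pu∧uv

  ball : ℕ → (Fin n → Bool) → Fin n → Bool
  ball zero    P   = P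
  ball (suc m) P v = ball m P v ∨ nbhd (ball m P) v

  -- the vertices at distance exactly suc m from P
  layer : ℕ → (Fin n → Bool) → Fin n → Bool
  layer m P v = nbhd (ball m P) v ∧ not (ball m P v)

  ball-suc⊇ : ∀ m P {v} → ball m P v ≡ true → ball (suc m) P v ≡ true
  ball-suc⊇ m P Bv rewrite Bv = refl

  ball-mono : ∀ {m m'} P {v} → m ≤ m' → ball m P v ≡ true → ball m' P v ≡ true
  ball-mono P m≤m' = go (≤⇒≤′ m≤m')
    where
    go : ∀ {m m' v} → m ≤′ m' → ball m P v ≡ true → ball m' P v ≡ true
    go ≤′-refl           = id
    go (≤′-step {m'} h) = ball-suc⊇ m' P ∘ go h

  ⊆ball : ∀ m P {v} → P v ≡ true → ball m P v ≡ true
  ⊆ball m P = ball-mono {0} {m} P z≤n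

  ball-suc-adj : ∀ m P {u v} → ball m P u ≡ true → adj G u v ≡ true → ball (suc m) P v ≡ true
  ball-suc-adj m P {v = v} Bu uv = trans (cong (ball m P v ∨_) (nbhd-intro Bu uv)) (∨-zeroʳ _)

  count-ball-suc : ∀ m P → count (ball (suc m) P) ≡ count (ball m P) + count (layer m P)
  count-ball-suc m P = trans (sum-cong-≗ λ v → split (ball m P v) (nbhd (ball m P) v)) (∑-distrib-+ {n} _ _)
    where
    split : ∀ a b → ⟦ a ∨ b ⟧ ≡ ⟦ a ⟧ + ⟦ b ∧ not a ⟧
    split true  true  = refl
    split true  false = refl
    split false b     rewrite ∧-identityʳ b = refl

  degree≤⇒count-adj≤ : ∀ {Δ} → (∀ v → degree G v ≤ Δ) → ∀ v → count (adj G v) ≤ Δ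
  degree≤⇒count-adj≤ deg≤ v = subst (_≤ _) (countFin≡count n (adj G v)) (deg≤ v)

  count-nbhd∖≤ : ∀ (Q R : Fin n → Bool) → count (λ v → nbhd Q v ∧ not (R v))
                      ≤ sum (λ u → ⟦ Q u ⟧ * count (λ v → adj G u v ∧ not (R v)))
  count-nbhd∖≤ Q R = begin
    sum (λ v → ⟦ nbhd Q v ∧ not (R v) ⟧)                     ≤⟨ sum-mono-≤ pointwise ⟩
    sum (λ v → sum (λ u → ⟦ Q u ⟧ * ⟦ adj G u v ∧ not (R v) ⟧)) ≡⟨ ∑-comm {n} {n} _ ⟩
    sum (λ u → sum (λ v → ⟦ Q u ⟧ * ⟦ adj G u v ∧ not (R v) ⟧)) ≡⟨ sum-cong-≗ (λ u → sym (*-distribˡ-sum {n} ⟦ Q u ⟧ _)) ⟩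
    sum (λ u → ⟦ Q u ⟧ * count (λ v → adj G u v ∧ not (R v)))   ∎
    where
    open ≤-Reasoning
    pointwise : ∀ v → ⟦ nbhd Q v ∧ not (R v) ⟧ ≤ sum (λ u → ⟦ Q u ⟧ * ⟦ adj G u v ∧ not (R v) ⟧)
    pointwise v = begin
      ⟦ nbhd Q v ∧ not (R v) ⟧                               ≡⟨ ⟦∧⟧ (nbhd Q v) _ ⟩
      ⟦ nbhd Q v ⟧ * ⟦ not (R v) ⟧                            ≤⟨ *-monoˡ-≤ ⟦ not (R v) ⟧ (⟦anyᶠ⟧≤count {n} _) ⟩
      sum (λ u → ⟦ Q u ∧ adj G u v ⟧) * ⟦ not (R v) ⟧        ≡⟨ *-distribʳ-sum {n} ⟦ not (R v) ⟧ _ ⟩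
      sum (λ u → ⟦ Q u ∧ adj G u v ⟧ * ⟦ not (R v) ⟧)        ≡⟨ sum-cong-≗ {n} reassoc ⟩
      sum (λ u → ⟦ Q u ⟧ * ⟦ adj G u v ∧ not (R v) ⟧)        ∎
      where
      reassoc : ∀ u → ⟦ Q u ∧ adj G u v ⟧ * ⟦ not (R v) ⟧ ≡ ⟦ Q u ⟧ * ⟦ adj G u v ∧ not (R v) ⟧
      reassoc u = begin-equality
        ⟦ Q u ∧ adj G u v ⟧ * ⟦ not (R v) ⟧          ≡⟨ cong (_* ⟦ not (R v) ⟧) (⟦∧⟧ (Q u) (adj G u v)) ⟩
        ⟦ Q u ⟧ * ⟦ adj G u v ⟧ * ⟦ not (R v) ⟧      ≡⟨ *-assoc ⟦ Q u ⟧ ⟦ adj G u v ⟧ ⟦ not (R v) ⟧ ⟩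
        ⟦ Q u ⟧ * (⟦ adj G u v ⟧ * ⟦ not (R v) ⟧)    ≡⟨ cong (⟦ Q u ⟧ *_) (⟦∧⟧ (adj G u v) (not (R v))) ⟨
        ⟦ Q u ⟧ * ⟦ adj G u v ∧ not (R v) ⟧          ∎

  module _ {Δ : ℕ} (deg≤Δ : ∀ v → count (adj G v) ≤ Δ) where

    count-layer-zero : ∀ P → count (layer 0 P) ≤ count P * Δ
    count-layer-zero P = ≤-trans (count-nbhd∖≤ P P)
      (sum-⟦⟧*≤count* P _ λ u _ → ≤-trans (count-mono {n} λ v → ∧-conicalˡ _ _) (deg≤Δ u))

    layer-suc⊆ : ∀ m P v → layer (suc m) P v ≡ true →
                 (nbhd (layer m P) v ∧ not (ball (suc m) P v)) ≡ true
    layer-suc⊆ m P v Lv with nbhd-elim {ball (suc m) P} (∧-conicalˡ _ _ Lv)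
    ... | w , B'w , wv with ball m P w in Bw
    ...   | false = cong₂ _∧_ (nbhd-intro (cong₂ _∧_ B'w (cong not Bw)) wv) (∧-conicalʳ _ _ Lv)
    ...   | true  with trans (sym (cong not (ball-suc-adj m P Bw wv))) (∧-conicalʳ _ _ Lv)
    ...     | ()

    -- u has a neighbour in ball m P, which is not outside ball (suc m) P
    count-outward-adj : ∀ m P u → layer m P u ≡ true →
                        count (λ v → adj G u v ∧ not (ball (suc m) P v)) ≤ Δ ∸ 1
    count-outward-adj m P u Lu with nbhd-elim {ball m P} (∧-conicalˡ _ _ Lu)
    ... | z , Bz , zu = m+n≤o⇒m≤o∸n _ (begin
      count (λ v → adj G u v ∧ not (B' v)) + 1
        ≤⟨ +-monoʳ-≤ _ (count-pos (λ v → adj G u v ∧ B' v) (cong₂ _∧_ (trans (symm G u z) zu) (ball-suc⊇ m P Bz))) ⟩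
      count (λ v → adj G u v ∧ not (B' v)) + count (λ v → adj G u v ∧ B' v)
        ≡⟨ count-split (adj G u) B' ⟨
      count (adj G u)
        ≤⟨ deg≤Δ u ⟩
      Δ ∎)
      where
      open ≤-Reasoning
      B' = ball (suc m) P

    count-layer-suc : ∀ m P → count (layer (suc m) P) ≤ count (layer m P) * (Δ ∸ 1)
    count-layer-suc m P = begin
      count (layer (suc m) P)                                         ≤⟨ count-mono (layer-suc⊆ m P) ⟩
      count (λ v → nbhd (layer m P) v ∧ not (ball (suc m) P v))       ≤⟨ count-nbhd∖≤ (layer m P) (ball (suc m) P) ⟩
      sum (λ u → ⟦ layer m P u ⟧ * count (λ v → adj G u v ∧ not (ball (suc m) P v)))
        ≤⟨ sum-⟦⟧*≤count* (layer m P) _ (count-outward-adj m P) ⟩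
      count (layer m P) * (Δ ∸ 1)                                      ∎
      where open ≤-Reasoning

    count-layer : ∀ m P → count (layer m P) ≤ count P * Δ * (Δ ∸ 1) ^ m
    count-layer zero    P = ≤-trans (count-layer-zero P) (≤-reflexive (sym (*-identityʳ _)))
    count-layer (suc m) P = begin
      count (layer (suc m) P)             ≤⟨ count-layer-suc m P ⟩
      count (layer m P) * (Δ ∸ 1)         ≤⟨ *-monoˡ-≤ (Δ ∸ 1) (count-layer m P) ⟩
      count P * Δ * (Δ ∸ 1) ^ m * (Δ ∸ 1) ≡⟨ reorder (count P * Δ) ((Δ ∸ 1) ^ m) (Δ ∸ 1) ⟩
      count P * Δ * (Δ ∸ 1) ^ suc m       ∎
      where
      open ≤-Reasoning
      reorder : ∀ a x y → a * x * y ≡ a * (y * x)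
      reorder = solve-∀

  module _ {D : ℕ} (deg≤ : ∀ v → count (adj G v) ≤ 2 + D) where

    -- |ball m P| ≤ |P| (1 + Δ ((Δ − 1)^m − 1)/(Δ − 2)) for Δ = 2 + D, cleared of denominators
    moore-bound : ∀ m P → D * count (ball m P) + 2 * count P ≤ count P * (2 + D) * suc D ^ m
    moore-bound zero    P = ≤-reflexive (base (count P) D)
      where
      base : ∀ p D → D * p + 2 * p ≡ p * (2 + D) * 1
      base = solve-∀
    moore-bound (suc m) P = begin
      D * count (ball (suc m) P) + 2 * count P
        ≡⟨ cong (λ b → D * b + 2 * count P) (count-ball-suc m P) ⟩
      D * (count (ball m P) + count (layer m P)) + 2 * count P
        ≡⟨ regroup D (count (ball m P)) (count (layer m P)) (count P) ⟩
      (D * count (ball m P) + 2 * count P) + D * count (layer m P)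
        ≤⟨ +-mono-≤ (moore-bound m P) (*-monoʳ-≤ D (count-layer deg≤ m P)) ⟩
      count P * (2 + D) * suc D ^ m + D * (count P * (2 + D) * suc D ^ m)
        ≡⟨ collect D (count P * (2 + D)) (suc D ^ m) ⟩
      count P * (2 + D) * suc D ^ suc m ∎
      where
      open ≤-Reasoning
      regroup : ∀ D b l p → D * (b + l) + 2 * p ≡ (D * b + 2 * p) + D * l
      regroup = solve-∀
      collect : ∀ D a x → a * x + D * (a * x) ≡ a * ((1 + D) * x)
      collect = solve-∀

    count-ball≤ : ∀ m P → D * count (ball m P) ≤ count P * (2 + D) * suc D ^ m
    count-ball≤ m P = ≤-trans (m≤m+n _ _) (moore-bound m P)

  walk-snoc : ∀ {u v w l} → Walk G u v l → adj G v w ≡ true → Walk G u w (suc l)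
  walk-snoc here        vw = step vw here
  walk-snoc (step uw p) vw = step uw (walk-snoc p vw)

  walk-reverse : ∀ {u v l} → Walk G u v l → Walk G v u l
  walk-reverse here                = here
  walk-reverse (step {u} {w} uw p) = walk-snoc (walk-reverse p) (trans (symm G w u) uw)

  walk⇒ball : ∀ {v x l m} P → P x ≡ true → Walk G v x l → l ≤ m → ball m P v ≡ true
  walk⇒ball {m = m} P Px here                           _   = ⊆ball m P Px
  walk⇒ball {v}     P Px (step {w = w} {m = l} vw p) l<m =
    ball-mono P l<m (ball-suc-adj l P (walk⇒ball P Px p ≤-refl) (trans (symm G w v) vw))

-- Arithmetic

square-mono : ∀ {a b} → a ≤ b → a * a ≤ b * b
square-mono a≤b = *-mono-≤ a≤b a≤b

≤3*rest : ∀ {n r x} → n ≡ r + x → 3 * x ≤ 2 * n → n ≤ 3 * r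
≤3*rest {n} {r} {x} n≡r+x 3x≤2n = +-cancelʳ-≤ (2 * n) n (3 * r) (begin
  n + 2 * n           ≡⟨ cong (λ m → m + 2 * m) n≡r+x ⟩
  r + x + 2 * (r + x) ≡⟨ expand r x ⟩
  3 * r + 3 * x       ≤⟨ +-monoʳ-≤ (3 * r) 3x≤2n ⟩
  3 * r + 2 * n       ∎)
  where
  open ≤-Reasoning
  expand : ∀ r x → r + x + 2 * (r + x) ≡ 3 * r + 3 * x
  expand = solve-∀

4ab≤[a+b]² : ∀ a b → 4 * (a * b) ≤ (a + b) * (a + b)
4ab≤[a+b]² a b with ≤-total a b
... | inj₁ a≤b = subst (λ b → 4 * (a * b) ≤ (a + b) * (a + b)) (m+[n∸m]≡n a≤b) (≤-trans (m≤m+n _ _) (≤-reflexive (gap a (b ∸ a))))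
  where
  gap : ∀ a d → 4 * (a * (a + d)) + d * d ≡ (a + (a + d)) * (a + (a + d))
  gap = solve-∀
... | inj₂ b≤a = subst (λ a → 4 * (a * b) ≤ (a + b) * (a + b)) (m+[n∸m]≡n b≤a) (≤-trans (m≤m+n _ _) (≤-reflexive (gap b (a ∸ b))))
  where
  gap : ∀ b d → 4 * ((b + d) * b) + d * d ≡ (b + d + b) * (b + d + b)
  gap = solve-∀

-- (a − 3x)(a − 3y) ≥ 0, expanded without subtraction
gap-product : ∀ {a x y} → 3 * x ≤ a → 3 * y ≤ a → a * (3 * x) + a * (3 * y) ≤ a * a + 9 * (x * y)
gap-product {a} {x} {y} 3x≤a 3y≤a = begin
  a * (3 * x) + a * (3 * y)                             ≤⟨ m≤m+n _ (u * v) ⟩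
  a * (3 * x) + a * (3 * y) + u * v                     ≡⟨ cong₂ (λ a₁ a₂ → a₁ * (3 * x) + a₂ * (3 * y) + u * v) ev eu ⟨
  (3 * y + v) * (3 * x) + (3 * x + u) * (3 * y) + u * v ≡⟨ expand x y u v ⟩
  (3 * x + u) * (3 * y + v) + 9 * (x * y)               ≡⟨ cong₂ (λ a₁ a₂ → a₁ * a₂ + 9 * (x * y)) eu ev ⟩
  a * a + 9 * (x * y)                                   ∎
  where
  open ≤-Reasoning
  u = a ∸ 3 * x
  v = a ∸ 3 * y
  eu : 3 * x + u ≡ a
  eu = m+[n∸m]≡n 3x≤a
  ev : 3 * y + v ≡ a
  ev = m+[n∸m]≡n 3y≤a
  expand : ∀ x y u v → (3 * y + v) * (3 * x) + (3 * x + u) * (3 * y) + u * v ≡ (3 * x + u) * (3 * y + v) + 9 * (x * y)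
  expand = solve-∀

balanced-partition : ∀ {n r x y} → n ≡ r + x + y → 3 * x ≤ 2 * n → 3 * y ≤ 2 * n →
                     2 * (n * n) ≤ 9 * (x * y) + 6 * (n * r)
balanced-partition {n} {r} {x} {y} n≡r+x+y 3x≤2n 3y≤2n = +-cancelˡ-≤ (4 * (n * n)) _ _ (begin
  4 * (n * n) + 2 * (n * n)                              ≡⟨ collect n ⟩
  6 * (n * n)                                            ≡⟨ cong (λ m → 6 * (n * m)) n≡r+x+y ⟩
  6 * (n * (r + x + y))                                  ≡⟨ distribute n r x y ⟩
  6 * (n * r) + (2 * n * (3 * x) + 2 * n * (3 * y))      ≤⟨ +-monoʳ-≤ (6 * (n * r)) (gap-product {x = x} {y} 3x≤2n 3y≤2n) ⟩
  6 * (n * r) + (2 * n * (2 * n) + 9 * (x * y))          ≡⟨ regroup n r (9 * (x * y)) ⟩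
  4 * (n * n) + (9 * (x * y) + 6 * (n * r))              ∎)
  where
  open ≤-Reasoning
  collect : ∀ n → 4 * (n * n) + 2 * (n * n) ≡ 6 * (n * n)
  collect = solve-∀
  distribute : ∀ n r x y → 6 * (n * (r + x + y)) ≡ 6 * (n * r) + (2 * n * (3 * x) + 2 * n * (3 * y))
  distribute = solve-∀
  regroup : ∀ n r z → 6 * (n * r) + (2 * n * (2 * n) + z) ≡ 4 * (n * n) + (z + 6 * (n * r))
  regroup = solve-∀

2[2+D]²≤3D² : ∀ {D} → 10 ≤ D → 2 * ((2 + D) * (2 + D)) ≤ 3 * (D * D)
2[2+D]²≤3D² 10≤D with m≤n⇒∃[o]m+o≡n 10≤D
... | t , refl = subst (2 * ((12 + t) * (12 + t)) ≤_) (gap t) (m≤m+n _ _)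
  where
  gap : ∀ t → 2 * ((12 + t) * (12 + t)) + (12 + 12 * t + t * t) ≡ 3 * ((10 + t) * (10 + t))
  gap = solve-∀

even-arith-near : ∀ {n r s D E} → 144 * s ≤ (2 + D) * (2 + D) → 2 * ((2 + D) * (2 + D)) ≤ 3 * (D * D) →
                  n ≤ 12 * r → D * r ≤ s * (2 + D) * E →
                  4 * (n * n) * (D * D) ≤ 9 * (s * ((1 + D) * E * ((1 + D) * E))) * (D * D)
even-arith-near {n} {r} {s} {D} {E} 144s≤Δ² 2Δ²≤3D² n≤12r Dr≤ = begin
  4 * (n * n) * (D * D)                        ≤⟨ *-monoˡ-≤ (D * D) (*-monoʳ-≤ 4 (square-mono n≤12r)) ⟩
  4 * (12 * r * (12 * r)) * (D * D)            ≡⟨ e₁ r D ⟩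
  576 * (D * r * (D * r))                      ≤⟨ *-monoʳ-≤ 576 (square-mono Dr≤) ⟩
  576 * (s * Δ * E * (s * Δ * E))              ≡⟨ e₂ s Δ E ⟩
  4 * s * (144 * s * (Δ * Δ) * (E * E))        ≤⟨ *-monoʳ-≤ (4 * s) (*-monoˡ-≤ (E * E) (*-monoˡ-≤ (Δ * Δ) 144s≤Δ²)) ⟩
  4 * s * (Δ * Δ * (Δ * Δ) * (E * E))          ≡⟨ e₃ s Δ E ⟩
  s * (E * E) * (2 * (Δ * Δ) * (2 * (Δ * Δ))) ≤⟨ *-monoʳ-≤ (s * (E * E)) (square-mono (≤-trans 2Δ²≤3D² (*-monoʳ-≤ 3 (*-monoʳ-≤ D (n≤1+n D))))) ⟩
  s * (E * E) * (3 * (D * (1 + D)) * (3 * (D * (1 + D)))) ≡⟨ e₄ s E D ⟩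
  9 * (s * ((1 + D) * E * ((1 + D) * E))) * (D * D) ∎
  where
  open ≤-Reasoning
  Δ = 2 + D
  e₁ : ∀ r D → 4 * (12 * r * (12 * r)) * (D * D) ≡ 576 * (D * r * (D * r))
  e₁ = solve-∀
  e₂ : ∀ s Δ E → 576 * (s * Δ * E * (s * Δ * E)) ≡ 4 * s * (144 * s * (Δ * Δ) * (E * E))
  e₂ = solve-∀
  e₃ : ∀ s Δ E → 4 * s * (Δ * Δ * (Δ * Δ) * (E * E)) ≡ s * (E * E) * (2 * (Δ * Δ) * (2 * (Δ * Δ)))
  e₃ = solve-∀
  e₄ : ∀ s E D → s * (E * E) * (3 * (D * (1 + D)) * (3 * (D * (1 + D)))) ≡ 9 * (s * ((1 + D) * E * ((1 + D) * E))) * (D * D)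
  e₄ = solve-∀

even-arith-far : ∀ {n r s D M xy} → 2 * ((2 + D) * (2 + D)) ≤ 3 * (D * D) → 12 * r ≤ n →
                 2 * (n * n) ≤ 9 * xy + 6 * (n * r) → 4 * (D * D) * xy ≤ s * ((2 + D) * M * ((2 + D) * M)) →
                 4 * (n * n) * (D * D) ≤ 9 * (s * (M * M)) * (D * D)
even-arith-far {n} {r} {s} {D} {M} {xy} 2Δ²≤3D² 12r≤n 2n²≤ 4D²xy≤ = *-cancelˡ-≤ 3 (begin
  3 * (4 * (n * n) * (D * D))            ≡⟨ e₁ n D ⟩
  2 * (6 * (n * n * (D * D)))            ≤⟨ *-monoʳ-≤ 2 6n²D²≤ ⟩
  2 * (9 * (s * (Δ * M * (Δ * M))))      ≡⟨ e₂ s Δ M ⟩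
  9 * (s * (M * M)) * (2 * (Δ * Δ))      ≤⟨ *-monoʳ-≤ (9 * (s * (M * M))) 2Δ²≤3D² ⟩
  9 * (s * (M * M)) * (3 * (D * D))      ≡⟨ e₃ (9 * (s * (M * M))) D ⟩
  3 * (9 * (s * (M * M)) * (D * D))      ∎)
  where
  open ≤-Reasoning
  Δ = 2 + D
  12nr≤n² : 12 * (n * r) ≤ n * n
  12nr≤n² = subst (_≤ n * n) (*-comm-12 n r) (*-monoʳ-≤ n 12r≤n)
    where
    *-comm-12 : ∀ n r → n * (12 * r) ≡ 12 * (n * r)
    *-comm-12 = solve-∀
  6n²D²≤ : 6 * (n * n * (D * D)) ≤ 9 * (s * (Δ * M * (Δ * M)))
  6n²D²≤ = +-cancelʳ-≤ (2 * (n * n * (D * D))) _ _ (begin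
    6 * (n * n * (D * D)) + 2 * (n * n * (D * D))       ≡⟨ f₁ n D ⟩
    4 * (D * D) * (2 * (n * n))                         ≤⟨ *-monoʳ-≤ (4 * (D * D)) 2n²≤ ⟩
    4 * (D * D) * (9 * xy + 6 * (n * r))                ≡⟨ f₂ D xy (n * r) ⟩
    9 * (4 * (D * D) * xy) + 2 * (D * D) * (12 * (n * r)) ≤⟨ +-mono-≤ (*-monoʳ-≤ 9 4D²xy≤) (*-monoʳ-≤ (2 * (D * D)) 12nr≤n²) ⟩
    9 * (s * (Δ * M * (Δ * M))) + 2 * (D * D) * (n * n) ≡⟨ cong (9 * (s * (Δ * M * (Δ * M))) +_) (f₃ D n) ⟩
    9 * (s * (Δ * M * (Δ * M))) + 2 * (n * n * (D * D)) ∎)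
    where
    f₁ : ∀ n D → 6 * (n * n * (D * D)) + 2 * (n * n * (D * D)) ≡ 4 * (D * D) * (2 * (n * n))
    f₁ = solve-∀
    f₂ : ∀ D xy nr → 4 * (D * D) * (9 * xy + 6 * nr) ≡ 9 * (4 * (D * D) * xy) + 2 * (D * D) * (12 * nr)
    f₂ = solve-∀
    f₃ : ∀ D n → 2 * (D * D) * (n * n) ≡ 2 * (n * n * (D * D))
    f₃ = solve-∀
  e₁ : ∀ n D → 3 * (4 * (n * n) * (D * D)) ≡ 2 * (6 * (n * n * (D * D)))
  e₁ = solve-∀
  e₂ : ∀ s Δ M → 2 * (9 * (s * (Δ * M * (Δ * M)))) ≡ 9 * (s * (M * M)) * (2 * (Δ * Δ))
  e₂ = solve-∀
  e₃ : ∀ a D → a * (3 * (D * D)) ≡ 3 * (a * (D * D))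
  e₃ = solve-∀

-- Either the vertices near S make up a twelfth of the graph, and the Moore bound on them suffices,
-- or they do not, and the pair count does.
even-arith : ∀ {n r s D E xy} → 10 ≤ D → 144 * s ≤ (2 + D) * (2 + D) →
             2 * (n * n) ≤ 9 * xy + 6 * (n * r) →
             4 * (D * D) * xy ≤ s * ((2 + D) * ((1 + D) * E) * ((2 + D) * ((1 + D) * E))) →
             D * r ≤ s * (2 + D) * E →
             4 * (n * n) ≤ 9 * (s * ((1 + D) * E * ((1 + D) * E)))
even-arith {n} {r} {s} {D} {E} {xy} 10≤D 144s≤Δ² 2n²≤ 4D²xy≤ Dr≤ =
  *-cancelʳ-≤ _ _ (D * D) {{m*n≢0 D D}} ([ near , far ]′ (≤-total n (12 * r)))
  where
  instance
    D≢0 : NonZero D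
    D≢0 = >-nonZero (≤-trans (s≤s z≤n) 10≤D)
  near : n ≤ 12 * r → 4 * (n * n) * (D * D) ≤ 9 * (s * ((1 + D) * E * ((1 + D) * E))) * (D * D)
  near n≤12r = even-arith-near {n} {r} {s} {D} {E} 144s≤Δ² (2[2+D]²≤3D² 10≤D) n≤12r Dr≤
  far : 12 * r ≤ n → 4 * (n * n) * (D * D) ≤ 9 * (s * ((1 + D) * E * ((1 + D) * E))) * (D * D)
  far 12r≤n = even-arith-far {n} {r} {s} {D} {(1 + D) * E} {xy} (2[2+D]²≤3D² 10≤D) 12r≤n 2n²≤ 4D²xy≤

-- Δ/(Δ − 2) ≤ 1 + ε/3 as soon as Δ − 2 ≥ 6 (q + 1) and ε ≥ 1/(q + 1)
odd-arith : ∀ {n X Δ} p q → 2 + 6 * suc q ≤ Δ → (Δ ∸ 2) * n ≤ 3 * Δ * X → n * suc q ≤ (3 * suc q + suc p) * X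
odd-arith {n} {X} {suc (suc D)} p q (s≤s (s≤s 6Q≤D)) Dn≤ = *-cancelʳ-≤ _ _ D {{>-nonZero (≤-trans (s≤s z≤n) 6Q≤D)}} (begin
  n * Q * D                           ≡⟨ e₁ n Q D ⟩
  Q * (D * n)                         ≤⟨ *-monoʳ-≤ Q Dn≤ ⟩
  Q * (3 * (2 + D) * X)               ≡⟨ e₂ Q D X ⟩
  3 * Q * D * X + 6 * Q * X           ≤⟨ +-monoʳ-≤ (3 * Q * D * X) (*-monoˡ-≤ X (≤-trans 6Q≤D (m≤m*n D (suc p)))) ⟩
  3 * Q * D * X + D * suc p * X       ≡⟨ e₃ Q D (suc p) X ⟩
  (3 * Q + suc p) * X * D             ∎)
  where
  open ≤-Reasoning
  Q = suc q
  e₁ : ∀ n Q D → n * Q * D ≡ Q * (D * n)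
  e₁ = solve-∀
  e₂ : ∀ Q D X → Q * (3 * (2 + D) * X) ≡ 3 * Q * D * X + 6 * Q * X
  e₂ = solve-∀
  e₃ : ∀ Q D P X → 3 * Q * D * X + D * P * X ≡ (3 * Q + P) * X * D
  e₃ = solve-∀

thresholds-even : ∀ {c s Δ} → 12 ≤ c → 0 < s → c ^ 2 * s ≤ Δ ^ 2 → 12 ≤ Δ × 144 * s ≤ Δ * Δ
thresholds-even {c} {s} {Δ} 12≤c 0<s c²s≤Δ² = ≤-trans 12≤c c≤Δ , (begin
  144 * s    ≤⟨ *-monoˡ-≤ s (^-monoˡ-≤ 2 12≤c) ⟩
  c ^ 2 * s  ≤⟨ c²s≤Δ² ⟩
  Δ ^ 2      ≡⟨ cong (Δ *_) (*-identityʳ Δ) ⟩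
  Δ * Δ      ∎)
  where
  open ≤-Reasoning
  c≤Δ : c ≤ Δ
  c≤Δ with c ≤? Δ
  ... | yes c≤Δ = c≤Δ
  ... | no  c≰Δ = contradiction (≤-trans (m≤m*n (c ^ 2) s {{>-nonZero 0<s}}) c²s≤Δ²) (<⇒≱ (^-monoˡ-< 2 (≰⇒> c≰Δ)))

-- Separations

isA⇒inA : ∀ q → isA q ≡ true → q ≡ inA
isA⇒inA inA _ = refl

isB⇒inB : ∀ q → isB q ≡ true → q ≡ inB
isB⇒inB inB _ = refl

module Separated {n : ℕ} (G : Graph n) {k s : ℕ} (dist≤k : ∀ u v → DistLe G u v k)
                 (sep : HasSeparation G s) where

  part : Fin n → Part
  part = proj₁ sep

  S A B : Fin n → Bool
  S v = isS (part v)
  A v = isA (part v)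
  B v = isB (part v)

  3|A|≤2n : 3 * count A ≤ 2 * n
  3|A|≤2n = subst (λ a → 3 * a ≤ 2 * n) (countFin≡count n A) (proj₁ (proj₂ sep))

  3|B|≤2n : 3 * count B ≤ 2 * n
  3|B|≤2n = subst (λ b → 3 * b ≤ 2 * n) (countFin≡count n B) (proj₁ (proj₂ (proj₂ sep)))

  |S|≤s : count S ≤ s
  |S|≤s = subst (_≤ s) (countFin≡count n S) (proj₁ (proj₂ (proj₂ (proj₂ sep))))

  walk-through-S : ∀ {a b l} → Walk G a b l → part a ≡ inA → part b ≡ inB →
                   Σ (Fin n) λ x → S x ≡ true ×
                   Σ ℕ λ l₁ → Σ ℕ λ l₂ → l₁ + l₂ ≡ l × Walk G a x l₁ × Walk G x b l₂
  walk-through-S here a∈A a∈B with () ← trans (sym a∈A) a∈B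
  walk-through-S {a} (step {w = w} {m = l} aw p) a∈A b∈B with part w in w∈
  ... | inS = w , cong isS w∈ , 1 , l , refl , step aw here , p
  ... | inA with walk-through-S p w∈ b∈B
  ...   | x , x∈S , l₁ , l₂ , l₁+l₂≡l , p₁ , p₂ = x , x∈S , suc l₁ , l₂ , cong suc l₁+l₂≡l , step aw p₁ , p₂
  walk-through-S {a} (step {w = w} aw p) a∈A b∈B | inB
    with () ← trans (sym aw) (proj₂ (proj₂ (proj₂ (proj₂ sep))) a w a∈A w∈)

  A-B-walks-meet-S : ∀ {a b} → A a ≡ true → B b ≡ true →
                     Σ (Fin n) λ x → S x ≡ true ×
                     Σ ℕ λ l₁ → Σ ℕ λ l₂ → l₁ + l₂ ≤ k × Walk G a x l₁ × Walk G b x l₂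
  A-B-walks-meet-S {a} {b} a∈A b∈B with dist≤k a b
  ... | l , l≤k , p with walk-through-S p (isA⇒inA (part a) a∈A) (isB⇒inB (part b) b∈B)
  ...   | x , x∈S , l₁ , l₂ , l₁+l₂≡l , p₁ , p₂ =
    x , x∈S , l₁ , l₂ , subst (_≤ k) (sym l₁+l₂≡l) l≤k , p₁ , walk-reverse G p₂

  near : ℕ → Fin n → Bool
  near m = ball G m S

  farA farB : ℕ → Fin n → Bool
  farA m v = A v ∧ not (near m v)
  farB m v = B v ∧ not (near m v)

  3|farA|≤2n : ∀ m → 3 * count (farA m) ≤ 2 * n
  3|farA|≤2n m = ≤-trans (*-monoʳ-≤ 3 (count-mono {n} λ _ → ∧-conicalˡ _ _)) 3|A|≤2n

  3|farB|≤2n : ∀ m → 3 * count (farB m) ≤ 2 * n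
  3|farB|≤2n m = ≤-trans (*-monoʳ-≤ 3 (count-mono {n} λ _ → ∧-conicalˡ _ _)) 3|B|≤2n

  far⇒long : ∀ m {a x l} → not (near m a) ≡ true → S x ≡ true → Walk G a x l → m < l
  far⇒long m {l = l} a∉R x∈S p with l ≤? m
  ... | no  l≰m = ≰⇒> l≰m
  ... | yes l≤m with () ← trans (sym (cong not (walk⇒ball G S x∈S p l≤m))) a∉R

  partition : ∀ m → n ≡ count (near m) + count (farA m) + count (farB m)
  partition m = begin
    n
      ≡⟨ trans (sum-const n 1) (*-identityʳ n) ⟨
    sum {n} (λ _ → 1)
      ≡⟨ sum-cong-≗ {n} (λ v → one-part (part v) (near m v) (⊆ball G m S)) ⟩
    sum (λ v → ⟦ near m v ⟧ + ⟦ farA m v ⟧ + ⟦ farB m v ⟧)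
      ≡⟨ ∑-distrib-+ {n} _ _ ⟩
    sum (λ v → ⟦ near m v ⟧ + ⟦ farA m v ⟧) + count (farB m)
      ≡⟨ cong (_+ count (farB m)) (∑-distrib-+ {n} _ _) ⟩
    count (near m) + count (farA m) + count (farB m) ∎
    where
    open ≡-Reasoning
    one-part : ∀ q b → (isS q ≡ true → b ≡ true) → 1 ≡ ⟦ b ⟧ + ⟦ isA q ∧ not b ⟧ + ⟦ isB q ∧ not b ⟧
    one-part inA true  _    = refl
    one-part inA false _    = refl
    one-part inB true  _    = refl
    one-part inB false _    = refl
    one-part inS true  _    = refl
    one-part inS false S⇒b with () ← S⇒b refl

  no-far-pair⇒n≤3|near| : ∀ m → (∀ a b → farA m a ≡ true → farB m b ≡ true → ⊥) → n ≤ 3 * count (near m)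
  no-far-pair⇒n≤3|near| m no-pair with count≡0⊎witness (farA m) | count≡0⊎witness (farB m)
  ... | inj₂ (a , a∈) | inj₂ (b , b∈) = ⊥-elim (no-pair a b a∈ b∈)
  ... | inj₁ |farA|≡0 | _ = ≤3*rest {r = count (near m)} {count (farB m)} n≡r+y (3|farB|≤2n m)
    where
    n≡r+y : n ≡ count (near m) + count (farB m)
    n≡r+y = trans (partition m) (cong (_+ count (farB m)) (trans (cong (count (near m) +_) |farA|≡0) (+-identityʳ _)))
  ... | inj₂ _ | inj₁ |farB|≡0 = ≤3*rest {r = count (near m)} {count (farA m)} n≡r+x (3|farA|≤2n m)
    where
    n≡r+x : n ≡ count (near m) + count (farA m)
    n≡r+x = trans (partition m) (trans (cong (count (near m) + count (farA m) +_) |farB|≡0) (+-identityʳ _))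

  odd-diameter⇒no-far-pair : ∀ j → k ≡ 2 * j + 1 → ∀ a b → farA j a ≡ true → farB j b ≡ true → ⊥
  odd-diameter⇒no-far-pair j k≡2j+1 a b a∈ b∈
    with A-B-walks-meet-S (∧-conicalˡ _ _ a∈) (∧-conicalˡ _ _ b∈)
  ... | x , x∈S , l₁ , l₂ , l₁+l₂≤k , p₁ , p₂ = 1+n≰n (begin
    suc (2 * j + 1)  ≡⟨ double-suc j ⟩
    suc j + suc j    ≤⟨ +-mono-≤ (far⇒long j (∧-conicalʳ _ _ a∈) x∈S p₁) (far⇒long j (∧-conicalʳ _ _ b∈) x∈S p₂) ⟩
    l₁ + l₂          ≤⟨ l₁+l₂≤k ⟩
    k                ≡⟨ k≡2j+1 ⟩
    2 * j + 1        ∎)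
    where
    open ≤-Reasoning
    double-suc : ∀ j → suc (2 * j + 1) ≡ suc j + suc j
    double-suc = solve-∀

  even-diameter⇒common-centre : ∀ i → k ≡ 2 * suc i → ∀ a b → farA i a ≡ true → farB i b ≡ true →
    Σ (Fin n) λ x → S x ≡ true × ball G (suc i) ⁅ x ⁆ a ≡ true × ball G (suc i) ⁅ x ⁆ b ≡ true
  even-diameter⇒common-centre i k≡ a b a∈ b∈
    with A-B-walks-meet-S (∧-conicalˡ _ _ a∈) (∧-conicalˡ _ _ b∈)
  ... | x , x∈S , l₁ , l₂ , l₁+l₂≤k , p₁ , p₂ =
    x , x∈S , walk⇒ball G ⁅ x ⁆ (x∈⁅x⁆ x) p₁ l₁≤ , walk⇒ball G ⁅ x ⁆ (x∈⁅x⁆ x) p₂ l₂≤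
    where
    i<l₁ : i < l₁
    i<l₁ = far⇒long i (∧-conicalʳ _ _ a∈) x∈S p₁
    i<l₂ : i < l₂
    i<l₂ = far⇒long i (∧-conicalʳ _ _ b∈) x∈S p₂
    l₁+l₂≤ : l₁ + l₂ ≤ suc i + suc i
    l₁+l₂≤ = ≤-trans l₁+l₂≤k (≤-reflexive (trans k≡ (cong (suc i +_) (+-identityʳ (suc i)))))
    l₁≤ : l₁ ≤ suc i
    l₁≤ = +-cancelʳ-≤ l₂ l₁ (suc i) (≤-trans l₁+l₂≤ (+-monoʳ-≤ (suc i) i<l₂))
    l₂≤ : l₂ ≤ suc i
    l₂≤ = +-cancelˡ-≤ l₁ l₂ (suc i) (≤-trans l₁+l₂≤ (+-monoˡ-≤ (suc i) i<l₁))

  S-nonempty : Fin n → 0 < count S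
  S-nonempty v with count≡0⊎witness S
  ... | inj₂ (x , x∈S) = count-pos S x∈S
  ... | inj₁ |S|≡0 = ⊥-elim (<-irrefl refl (begin-strict
    0                  <⟨ fin-pos v ⟩
    n                  ≤⟨ no-far-pair⇒n≤3|near| 0 no-far-pair ⟩
    3 * count S        ≡⟨ cong (3 *_) |S|≡0 ⟩
    0                  ∎))
    where
    open ≤-Reasoning
    fin-pos : ∀ {m} → Fin m → 0 < m
    fin-pos {suc m} _ = z<s
    no-far-pair : ∀ a b → farA 0 a ≡ true → farB 0 b ≡ true → ⊥
    no-far-pair a b a∈ b∈ with A-B-walks-meet-S (∧-conicalˡ _ _ a∈) (∧-conicalˡ _ _ b∈)
    ... | x , x∈S , _ = <-irrefl (sym |S|≡0) (count-pos S x∈S)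

  D*|near|≤ : ∀ {D} → (∀ v → count (adj G v) ≤ 2 + D) → ∀ m → D * count (near m) ≤ s * (2 + D) * suc D ^ m
  D*|near|≤ {D} deg≤ m =
    ≤-trans (count-ball≤ G deg≤ m S) (*-monoˡ-≤ (suc D ^ m) (*-monoˡ-≤ (2 + D) |S|≤s))

  odd-diameter-bound : ∀ {Δ} → (∀ v → degree G v ≤ Δ) → ∀ j → k ≡ 2 * j + 1 →
                       (Δ ∸ 2) * n ≤ 3 * Δ * (s * (Δ ∸ 1) ^ j)
  odd-diameter-bound {zero}        _   _ _ = z≤n
  odd-diameter-bound {suc zero}    _   _ _ = z≤n
  odd-diameter-bound {suc (suc D)} deg≤ j k≡2j+1 = begin
    D * n                          ≤⟨ *-monoʳ-≤ D (no-far-pair⇒n≤3|near| j (odd-diameter⇒no-far-pair j k≡2j+1)) ⟩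
    D * (3 * count (near j))       ≡⟨ x*[3*y]≡3*[x*y] D (count (near j)) ⟩
    3 * (D * count (near j))       ≤⟨ *-monoʳ-≤ 3 (D*|near|≤ (degree≤⇒count-adj≤ G deg≤) j) ⟩
    3 * (s * (2 + D) * suc D ^ j)  ≡⟨ reorder s (2 + D) (suc D ^ j) ⟩
    3 * (2 + D) * (s * suc D ^ j)  ∎
    where
    open ≤-Reasoning
    x*[3*y]≡3*[x*y] : ∀ x y → x * (3 * y) ≡ 3 * (x * y)
    x*[3*y]≡3*[x*y] = solve-∀
    reorder : ∀ s Δ e → 3 * (s * Δ * e) ≡ 3 * Δ * (s * e)
    reorder = solve-∀

  module _ {D : ℕ} (deg≤ : ∀ v → count (adj G v) ≤ 2 + D) (i : ℕ) where

    private
      K : ℕ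
      K = (2 + D) * suc D ^ suc i

      around : Fin n → Fin n → Bool
      around x = ball G (suc i) ⁅ x ⁆

    4D²ab≤K² : ∀ x → 4 * (D * D) * (count (λ a → around x a ∧ farA i a) * count (λ b → around x b ∧ farB i b)) ≤ K * K
    4D²ab≤K² x = begin
      4 * (D * D) * (a * b)             ≡⟨ e₁ D a b ⟩
      4 * (D * a * (D * b))             ≤⟨ 4ab≤[a+b]² (D * a) (D * b) ⟩
      (D * a + D * b) * (D * a + D * b) ≡⟨ cong (λ m → m * m) (*-distribˡ-+ D a b) ⟨
      D * (a + b) * (D * (a + b))       ≤⟨ square-mono D[a+b]≤K ⟩
      K * K                             ∎
      where
      open ≤-Reasoning
      a = count (λ a → around x a ∧ farA i a)
      b = count (λ b → around x b ∧ farB i b)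
      e₁ : ∀ D a b → 4 * (D * D) * (a * b) ≡ 4 * (D * a * (D * b))
      e₁ = solve-∀
      A∩B=∅ : ∀ v → farA i v ≡ true → farB i v ≡ true → ⊥
      A∩B=∅ v a∈ b∈ with part v | ∧-conicalˡ (A v) _ a∈ | ∧-conicalˡ (B v) _ b∈
      ... | inA | _ | ()
      D[a+b]≤K : D * (a + b) ≤ K
      D[a+b]≤K = begin
        D * (a + b)                           ≤⟨ *-monoʳ-≤ D (count-disjoint (around x) (farA i) (farB i) A∩B=∅) ⟩
        D * count (around x)                  ≤⟨ count-ball≤ G deg≤ (suc i) ⁅ x ⁆ ⟩
        count ⁅ x ⁆ * (2 + D) * suc D ^ suc i ≡⟨ cong (λ c → c * (2 + D) * suc D ^ suc i) (count-⁅x⁆ x) ⟩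
        1 * (2 + D) * suc D ^ suc i           ≡⟨ cong (_* suc D ^ suc i) (*-identityˡ (2 + D)) ⟩
        K                                     ∎

    4D²|farA||farB|≤sK² : k ≡ 2 * suc i → 4 * (D * D) * (count (farA i) * count (farB i)) ≤ s * (K * K)
    4D²|farA||farB|≤sK² k≡ = begin
      4 * (D * D) * (count (farA i) * count (farB i))
        ≤⟨ *-monoʳ-≤ (4 * (D * D)) (count*count≤ (farA i) (farB i) S around (even-diameter⇒common-centre i k≡)) ⟩
      4 * (D * D) * sum (λ x → ⟦ S x ⟧ * ab x)
        ≡⟨ *-distribˡ-sum {n} (4 * (D * D)) _ ⟩
      sum (λ x → 4 * (D * D) * (⟦ S x ⟧ * ab x))
        ≡⟨ sum-cong-≗ {n} (λ x → x*[y*z]≡y*[x*z] (4 * (D * D)) ⟦ S x ⟧ (ab x)) ⟩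
      sum (λ x → ⟦ S x ⟧ * (4 * (D * D) * ab x))
        ≤⟨ sum-⟦⟧*≤count* S _ (λ x _ → 4D²ab≤K² x) ⟩
      count S * (K * K)
        ≤⟨ *-monoˡ-≤ (K * K) |S|≤s ⟩
      s * (K * K) ∎
      where
      open ≤-Reasoning
      ab : Fin n → ℕ
      ab x = count (λ a → around x a ∧ farA i a) * count (λ b → around x b ∧ farB i b)
      x*[y*z]≡y*[x*z] : ∀ x y z → x * (y * z) ≡ y * (x * z)
      x*[y*z]≡y*[x*z] = solve-∀

  edge⇒0<k : ∀ {u v} → adj G u v ≡ true → 0 < k
  edge⇒0<k {u} {v} uv with dist≤k u v
  ... | suc _ , l<k , _ = <-≤-trans z<s l<k
  ... | zero  , _   , here with () ← trans (sym uv) (irrefl G u)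

  even-diameter-bound : ∀ {Δ} → MaxDegree G Δ → 12 ≤ Δ → 144 * s ≤ Δ * Δ → ∀ j → k ≡ 2 * j →
                        4 * (n * n) ≤ 9 * (s * (Δ ∸ 1) ^ (2 * j))
  even-diameter-bound (_ , v , degv≡Δ) 12≤Δ _ zero k≡0 with count≡0⊎witness (adj G v)
  ... | inj₂ (u , vu) = ⊥-elim (<-irrefl (sym k≡0) (edge⇒0<k vu))
  ... | inj₁ |adj|≡0
    with () ← ≤-trans 12≤Δ (≤-reflexive (trans (sym degv≡Δ) (trans (countFin≡count n (adj G v)) |adj|≡0)))
  even-diameter-bound {suc (suc D)} (deg≤ , _) (s≤s (s≤s 10≤D)) 144s≤Δ² (suc i) k≡ =
    subst (λ e → 4 * (n * n) ≤ 9 * (s * e)) (sym (m^[n+n]≡m^n*m^n (suc D) (suc i)))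
      (even-arith {n} {count (near i)} {s} {D} {suc D ^ i} {count (farA i) * count (farB i)} 10≤D 144s≤Δ²
        (balanced-partition {x = count (farA i)} {count (farB i)} (partition i) (3|farA|≤2n i) (3|farB|≤2n i))
        (4D²|farA||farB|≤sK² deg≤' i k≡)
        (D*|near|≤ deg≤' i))
    where
    deg≤' = degree≤⇒count-adj≤ G deg≤
    m^[n+n]≡m^n*m^n : ∀ m n → m ^ (2 * n) ≡ m ^ n * m ^ n
    m^[n+n]≡m^n*m^n m n = trans (^-distribˡ-+-* m n (n + 0)) (cong (λ e → m ^ n * m ^ e) (+-identityʳ n))

-- From ℕ to ℚ

-- opened only now: with +_ in scope, sections such as (k +_) above would not parse
open import Data.Integer using (+_)

private
  +*+ : ∀ a b → + a ℤ.* + b ≡ + (a * b)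
  +*+ a b = sym (ℤ.pos-* a b)

ℕ/1≃ : ∀ a → toℚᵘ (+ a / 1) ℚᵘ.≃ mkℚᵘ (+ a) 0
ℕ/1≃ a = toℚᵘ-fromℚᵘ (mkℚᵘ (+ a) 0)

ℕ/1≤-viaᵘ : ∀ {a} {x : ℚ} (u : ℚᵘ) → toℚᵘ x ℚᵘ.≃ u → + a ℤ.* ℚᵘ.↧ u ℤ.≤ ℚᵘ.↥ u → (+ a / 1) ℚ.≤ x
ℕ/1≤-viaᵘ {a} u x≃u a↧u≤↥u = toℚᵘ-cancel-≤
  (ℚᵘ.≤-respˡ-≃ (ℚᵘ.≃-sym (ℕ/1≃ a)) (ℚᵘ.≤-respʳ-≃ (ℚᵘ.≃-sym x≃u) (*≤* (subst (+ a ℤ.* ℚᵘ.↧ u ℤ.≤_) (sym (ℤ.*-identityʳ (ℚᵘ.↥ u))) a↧u≤↥u))))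

≤[3+ε]* : ∀ {n X} p q .{c : Coprime (suc p) (suc q)} → n * suc q ≤ (3 * suc q + suc p) * X →
          (+ n / 1) ℚ.≤ ((+ 3 / 1) ℚ.+ mkℚ +[1+ p ] q c) ℚ.* (+ X / 1)
≤[3+ε]* {n} {X} p q {c} h = ℕ/1≤-viaᵘ {n} u to-u (subst₂ ℤ._≤_ (sym n↧u) (sym ↥u) (+≤+ h))
  where
  u : ℚᵘ
  u = (mkℚᵘ (+ 3) 0 ℚᵘ.+ mkℚᵘ +[1+ p ] q) ℚᵘ.* mkℚᵘ (+ X) 0
  to-u : toℚᵘ (((+ 3 / 1) ℚ.+ mkℚ +[1+ p ] q c) ℚ.* (+ X / 1)) ℚᵘ.≃ u
  to-u = ℚᵘ.≃-trans (toℚᵘ-homo-* ((+ 3 / 1) ℚ.+ mkℚ +[1+ p ] q c) (+ X / 1))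
           (ℚᵘ.*-cong (toℚᵘ-homo-+ (+ 3 / 1) (mkℚ +[1+ p ] q c)) (ℕ/1≃ X))
  n↧u : + n ℤ.* ℚᵘ.↧ u ≡ + (n * suc q)
  n↧u = trans (+*+ n _) (cong (λ d → + (n * d)) (1*d*1≡d (suc q)))
    where
    1*d*1≡d : ∀ d → 1 * d * 1 ≡ d
    1*d*1≡d = solve-∀
  ↥u : ℚᵘ.↥ u ≡ + ((3 * suc q + suc p) * X)
  ↥u = begin
    (+ 3 ℤ.* + suc q ℤ.+ + suc p ℤ.* + 1) ℤ.* + X ≡⟨ cong₂ (λ a b → (a ℤ.+ b) ℤ.* + X) (+*+ 3 (suc q)) (+*+ (suc p) 1) ⟩
    + (3 * suc q + suc p * 1) ℤ.* + X             ≡⟨ +*+ (3 * suc q + suc p * 1) X ⟩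
    + ((3 * suc q + suc p * 1) * X)               ≡⟨ cong (λ b → + ((3 * suc q + b) * X)) (*-identityʳ (suc p)) ⟩
    + ((3 * suc q + suc p) * X)                   ∎
    where open ≡-Reasoning

≤[3/2+ε]²* : ∀ {n Y} p q .{c : Coprime (suc p) (suc q)} → 4 * (n * n) ≤ 9 * Y →
             (+ (n ^ 2) / 1) ℚ.≤ ((+ 3 / 2) ℚ.+ mkℚ +[1+ p ] q c) ℚ.* ((+ 3 / 2) ℚ.+ mkℚ +[1+ p ] q c) ℚ.* (+ Y / 1)
≤[3/2+ε]²* {n} {Y} p q {c} h = ℕ/1≤-viaᵘ {n ^ 2} u to-u (subst₂ ℤ._≤_ (sym n²↧u) (sym ↥u) (+≤+ ℕ-bound))
  where
  ε = mkℚ +[1+ p ] q c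
  Q = suc q
  a b : ℕ
  a = 3 * Q + suc p * 2
  b = 2 * Q
  3/2+εᵘ : ℚᵘ
  3/2+εᵘ = mkℚᵘ (+ 3) 1 ℚᵘ.+ mkℚᵘ +[1+ p ] q
  u : ℚᵘ
  u = 3/2+εᵘ ℚᵘ.* 3/2+εᵘ ℚᵘ.* mkℚᵘ (+ Y) 0
  to-3/2+εᵘ : toℚᵘ ((+ 3 / 2) ℚ.+ ε) ℚᵘ.≃ 3/2+εᵘ
  to-3/2+εᵘ = toℚᵘ-homo-+ (+ 3 / 2) ε
  to-u : toℚᵘ (((+ 3 / 2) ℚ.+ ε) ℚ.* ((+ 3 / 2) ℚ.+ ε) ℚ.* (+ Y / 1)) ℚᵘ.≃ u
  to-u = ℚᵘ.≃-trans (toℚᵘ-homo-* (((+ 3 / 2) ℚ.+ ε) ℚ.* ((+ 3 / 2) ℚ.+ ε)) (+ Y / 1))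
           (ℚᵘ.*-cong (ℚᵘ.≃-trans (toℚᵘ-homo-* ((+ 3 / 2) ℚ.+ ε) ((+ 3 / 2) ℚ.+ ε))
                                   (ℚᵘ.*-cong to-3/2+εᵘ to-3/2+εᵘ))
                      (ℕ/1≃ Y))
  n²↧u : + (n ^ 2) ℤ.* ℚᵘ.↧ u ≡ + (n ^ 2 * (b * b * 1))
  n²↧u = +*+ (n ^ 2) _
  ↥u : ℚᵘ.↥ u ≡ + (a * a * Y)
  ↥u = begin
    ℚᵘ.↥ 3/2+εᵘ ℤ.* ℚᵘ.↥ 3/2+εᵘ ℤ.* + Y ≡⟨ cong (λ z → z ℤ.* z ℤ.* + Y) (cong₂ ℤ._+_ (+*+ 3 Q) (+*+ (suc p) 2)) ⟩
    + a ℤ.* + a ℤ.* + Y                 ≡⟨ cong (ℤ._* + Y) (+*+ a a) ⟩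
    + (a * a) ℤ.* + Y                   ≡⟨ +*+ (a * a) Y ⟩
    + (a * a * Y)                       ∎
    where open ≡-Reasoning
  ℕ-bound : n ^ 2 * (b * b * 1) ≤ a * a * Y
  ℕ-bound = begin
    n ^ 2 * (b * b * 1)      ≡⟨ e₁ n Q ⟩
    4 * (n * n) * (Q * Q)    ≤⟨ *-monoˡ-≤ (Q * Q) h ⟩
    9 * Y * (Q * Q)          ≡⟨ e₂ Y Q ⟩
    3 * Q * (3 * Q) * Y      ≤⟨ *-monoˡ-≤ Y (*-mono-≤ 3Q≤a 3Q≤a) ⟩
    a * a * Y                ∎
    where
    open ≤-Reasoning
    3Q≤a : 3 * Q ≤ a
    3Q≤a = m≤m+n _ _
    e₁ : ∀ n Q → n * (n * 1) * (2 * Q * (2 * Q) * 1) ≡ 4 * (n * n) * (Q * Q)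
    e₁ = solve-∀
    e₂ : ∀ Y Q → 9 * Y * (Q * Q) ≡ 3 * Q * (3 * Q) * Y
    e₂ = solve-∀

mainTheorem8 : (ε : ℚ) → 0ℚ ℚ.< ε →
    Σ ℕ λ c →
      ∀ (n : ℕ) (G : Graph n) (Δ k s : ℕ) →
        MaxDegree G Δ → Diameter G k → HasSeparation G s →
        (∀ j → k ≡ 2 * j + 1 → Δ ≥ c →
          (+ n / 1) ℚ.≤ ((+ 3 / 1) ℚ.+ ε) ℚ.* (+ (s * (Δ ∸ 1) ^ j) / 1))
        × (∀ j → k ≡ 2 * j → Δ ^ 2 ≥ c ^ 2 * s →
          (+ (n ^ 2) / 1) ℚ.≤ ((+ 3 / 2) ℚ.+ ε) ℚ.* ((+ 3 / 2) ℚ.+ ε) ℚ.* (+ (s * (Δ ∸ 1) ^ (2 * j)) / 1))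
mainTheorem8 (mkℚ (+ zero)   _ _) (*<* (+<+ ()))
mainTheorem8 (mkℚ -[1+ _ ]   _ _) (*<* ())
mainTheorem8 (mkℚ +[1+ p ] q coprime) _ = 12 + 6 * suc q , λ n G Δ k s maxDeg (dist≤k , _) sep →
  let open Separated G dist≤k sep
      (deg≤Δ , v , _) = maxDeg
  in (λ j k≡2j+1 c≤Δ →
        ≤[3+ε]* {n} {s * (Δ ∸ 1) ^ j} p q {coprime}
          (odd-arith p q (≤-trans (+-monoˡ-≤ (6 * suc q) (m≤m+n 2 10)) c≤Δ) (odd-diameter-bound deg≤Δ j k≡2j+1)))
   , (λ j k≡2j c²s≤Δ² →
        let (12≤Δ , 144s≤Δ²) = thresholds-even (m≤m+n 12 (6 * suc q)) (≤-trans (S-nonempty v) |S|≤s) c²s≤Δ²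
        in ≤[3/2+ε]²* {n} {s * (Δ ∸ 1) ^ (2 * j)} p q {coprime} (even-diameter-bound maxDeg 12≤Δ 144s≤Δ² j k≡2j))
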